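{- For any two non-trivial finite simple connected graphs $G$ and $H$, $$\gamma_{P,c}(G\,\square\,H)\leq \min\{\gamma_{P,c}(G)\,|V(H)|,\ \gamma_{P,c}(H)\,|V(G)|\}.$$
   Context: For a graph $G$ and $S\subseteq V(G)$, the set $M(S)$ of vertices monitored by $S$ is built as follows: initially $M(S)=N[S]$; then, as long as there is a vertex $v\in M(S)$ with exactly one neighbour $w$ outside $M(S)$, add $w$ to $M(S)$. $S$ is a connected power dominating set if $M(S)=V(G)$ and the induced subgraph $\langle S\rangle$ is connected; $\gamma_{P,c}(G)$ is the minimum cardinality of such a set. The Cartesian product $G\,\square\,H$ has vertex set $V(G)\times V(H)$, with $(a,b)$ adjacent to $(x,y)$ iff either $a=x$ and $by\in E(H)$, or $b=y$ and $ax\in E(G)$. -}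

module Defs where

open import Data.Nat using (ℕ; _*_; _≤_; _⊓_)
open import Data.Fin using (Fin; remQuot)
open import Data.Fin.Subset using (Subset; _∈_; _∉_; ∣_∣; ⊤)
open import Data.Product using (Σ; ∃; _×_; _,_; proj₁; proj₂)
open import Data.Sum using (_⊎_)
open import Relation.Binary.PropositionalEquality using (_≡_; _≢_)
open import Relation.Nullary using (¬_)

record Graph (n : ℕ) : Set₁ where
  field
    Adj : Fin n → Fin n → Set
open Graph public

IsSimple : ∀ {n} → Graph n → Set
IsSimple {n} G = (∀ (u v : Fin n) → Adj G u v → Adj G v u) × (∀ (u : Fin n) → ¬ Adj G u u)

data WalkIn {n : ℕ} (G : Graph n) (S : Subset n) : Fin n → Fin n → Set where
  here : ∀ {u} → u ∈ S → WalkIn G S u u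
  step : ∀ {u v w} → u ∈ S → Adj G u v → WalkIn G S v w → WalkIn G S u w

IsConnected : ∀ {n} → Graph n → Set
IsConnected {n} G = ∀ (u v : Fin n) → WalkIn G ⊤ u v

InducedConnected : ∀ {n} → Graph n → Subset n → Set
InducedConnected {n} G S = ∀ (u v : Fin n) → u ∈ S → v ∈ S → WalkIn G S u v

-- M(S): the set of vertices monitored by S, as the least set that contains N[S]
-- and is closed under the propagation rule (a monitored vertex u all of whose
-- neighbours other than v are monitored forces its neighbour v).
data Monitored {n : ℕ} (G : Graph n) (S : Subset n) : Fin n → Set where
  inS   : ∀ {v} → v ∈ S → Monitored G S v
  nbr   : ∀ {s v} → s ∈ S → Adj G s v → Monitored G S v
  force : ∀ {u v} → Monitored G S u → Adj G u v →
          (∀ w → Adj G u w → w ≢ v → Monitored G S w) → Monitored G S v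

IsCPDS : ∀ {n} → Graph n → Subset n → Set
IsCPDS {n} G S = (∀ (v : Fin n) → Monitored G S v) × InducedConnected G S

IsγPc : ∀ {n} → Graph n → ℕ → Set
IsγPc {n} G k = (Σ (Subset n) λ S → IsCPDS G S × ∣ S ∣ ≡ k)
              × (∀ (S : Subset n) → IsCPDS G S → k ≤ ∣ S ∣)

_□_ : ∀ {m n} → Graph m → Graph n → Graph (m * n)
Adj (_□_ {m} {n} G H) i j =
  let a = proj₁ (remQuot {m} n i) ; b = proj₂ (remQuot {m} n i)
      x = proj₁ (remQuot {m} n j) ; y = proj₂ (remQuot {m} n j)
  in (a ≡ x × Adj H b y) ⊎ (b ≡ y × Adj G a x)

{-# OPTIONS --safe #-}
module Submission where

-- If S is a connected power dominating set of G, so is its preimage S × V(H)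
-- in G □ H, of size |S| |V(H)|.  Viewing G □ H over G via the first coordinate,
-- every edge of G lifts uniquely into each layer G × {b}; hence N[S] and each
-- forcing step of G lift layer by layer (a vertex (u , b) has, outside the
-- fibre over u, only the lifts of G-neighbours of u), and walks of ⟨S⟩ lift to
-- walks in the preimage, whose fibres are connected copies of H.  The same
-- holds with the roles of G and H exchanged, and minimality of γ_{P,c}(G □ H)
-- gives the bound.

open import Defs
open import Data.Nat using (ℕ; _*_; _≤_; _⊓_; _+_; zero; suc)
open import Data.Nat.Properties using (⊓-glb; ≤-trans; ≤-reflexive; *-comm)
open import Data.Bool using (true; false)
open import Data.Fin using (Fin; remQuot; combine)
open import Data.Fin.Properties using (remQuot-combine; combine-remQuot)
open import Data.Fin.Subset using (Subset; _∈_; ∣_∣; ⊤)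
open import Data.Fin.Subset.Properties using (∣⊤∣≡n; ∣⊥∣≡0)
open import Data.Vec using (_∷_; []; _++_; concat; map; replicate; lookup)
open import Data.Vec.Properties using (lookup-concat; lookup-map; lookup-replicate; []=⇒lookup; lookup⇒[]=)
open import Data.Product using (_×_; _,_; proj₁; proj₂)
open import Data.Sum using (_⊎_; inj₁; inj₂)
open import Relation.Binary.PropositionalEquality

∣p++q∣≡∣p∣+∣q∣ : ∀ {a b} (p : Subset a) (q : Subset b) → ∣ p ++ q ∣ ≡ ∣ p ∣ + ∣ q ∣
∣p++q∣≡∣p∣+∣q∣ [] q = refl
∣p++q∣≡∣p∣+∣q∣ (true ∷ p) q = cong suc (∣p++q∣≡∣p∣+∣q∣ p q)
∣p++q∣≡∣p∣+∣q∣ (false ∷ p) q = ∣p++q∣≡∣p∣+∣q∣ p q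

∣concat-map-replicate∣ : ∀ {m} n (p : Subset m) → ∣ concat (map (replicate n) p) ∣ ≡ ∣ p ∣ * n
∣concat-map-replicate∣ n [] = refl
∣concat-map-replicate∣ n (true ∷ p) =
  trans (∣p++q∣≡∣p∣+∣q∣ (replicate n true) _) (cong₂ _+_ (∣⊤∣≡n n) (∣concat-map-replicate∣ n p))
∣concat-map-replicate∣ n (false ∷ p) =
  trans (∣p++q∣≡∣p∣+∣q∣ (replicate n false) _) (cong₂ _+_ (∣⊥∣≡0 n) (∣concat-map-replicate∣ n p))

∣concat-replicate∣ : ∀ m {n} (p : Subset n) → ∣ concat (replicate m p) ∣ ≡ m * ∣ p ∣
∣concat-replicate∣ zero p = refl
∣concat-replicate∣ (suc m) p = trans (∣p++q∣≡∣p∣+∣q∣ p _) (cong (∣ p ∣ +_) (∣concat-replicate∣ m p))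

_++ʷ_ : ∀ {n} {K : Graph n} {S u v w} → WalkIn K S u v → WalkIn K S v w → WalkIn K S u w
here _ ++ʷ q = q
step x a p ++ʷ q = step x a (p ++ʷ q)

-- K viewed over G: shift i u is the vertex over u in the layer through i
-- (for G □ H, the layers are the copies G × {b} and the fibres of π are the copies {a} × H).
record Projection {N m : ℕ} (K : Graph N) (G : Graph m) : Set where
  field
    π           : Fin N → Fin m
    shift       : Fin N → Fin m → Fin N
    π-shift     : ∀ i u → π (shift i u) ≡ u
    shift-π     : ∀ i → shift i (π i) ≡ i
    shift-shift : ∀ i u v → shift (shift i u) v ≡ shift i v
    adj-shift   : ∀ {i u} → Adj G (π i) u → Adj K i (shift i u)
    shift-adj   : ∀ {i u} → Adj G u (π i) → Adj K (shift i u) i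
    adj-split   : ∀ {i k} → Adj K i k → π i ≡ π k ⊎ (Adj G (π i) (π k) × k ≡ shift i (π k))
    fibre-walk  : ∀ {i j} (P : Subset N) → (∀ k → π k ≡ π j → k ∈ P) →
                  π i ≡ π j → WalkIn K P i j

module Preimage {N m} {K : Graph N} {G : Graph m} (p : Projection K G)
                (S : Subset m) (S′ : Subset N)
                (lookup-S′ : ∀ i → lookup S′ i ≡ lookup S (Projection.π p i)) where
  open Projection p

  ∈-preimage : ∀ {i} → π i ∈ S → i ∈ S′
  ∈-preimage {i} x = lookup⇒[]= i S′ (trans (lookup-S′ i) ([]=⇒lookup x))

  preimage-∈ : ∀ {i} → i ∈ S′ → π i ∈ S
  preimage-∈ {i} x = lookup⇒[]= (π i) S (trans (sym (lookup-S′ i)) ([]=⇒lookup x))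

  monitored-lift : ∀ {u} → Monitored G S u → ∀ i → π i ≡ u → Monitored K S′ i
  monitored-lift (inS x) i refl = inS (∈-preimage x)
  monitored-lift (nbr {s} x a) i refl =
    nbr (∈-preimage (subst (_∈ S) (sym (π-shift i s)) x)) (shift-adj a)
  monitored-lift (force {u} mu a forced) i refl =
    force (monitored-lift mu (shift i u) (π-shift i u)) (shift-adj a) others
    where
    others : ∀ k → Adj K (shift i u) k → k ≢ i → Monitored K S′ k
    others k a′ k≢i with adj-split a′
    ... | inj₁ same-fibre = monitored-lift mu k (trans (sym same-fibre) (π-shift i u))
    ... | inj₂ (g , k≡shift) =
      monitored-lift (forced (π k) (subst (λ z → Adj G z (π k)) (π-shift i u) g) πk≢πi) k refl
      where
      πk≢πi : π k ≢ π i
      πk≢πi e = k≢i (begin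
        k                           ≡⟨ k≡shift ⟩
        shift (shift i u) (π k)     ≡⟨ cong (shift (shift i u)) e ⟩
        shift (shift i u) (π i)     ≡⟨ shift-shift i u (π i) ⟩
        shift i (π i)               ≡⟨ shift-π i ⟩
        i                           ∎)
        where open ≡-Reasoning

  walk-lift : ∀ {a x} → WalkIn G S a x → ∀ i → π i ≡ a → WalkIn K S′ i (shift i x)
  walk-lift (here x) i refl = subst (WalkIn K S′ i) (sym (shift-π i)) (here (∈-preimage x))
  walk-lift (step {v = v} {w = x} s g w) i refl =
    step (∈-preimage s) (adj-shift g)
      (subst (WalkIn K S′ (shift i v)) (shift-shift i v x) (walk-lift w (shift i v) (π-shift i v)))

  cpds-lift : IsCPDS G S → IsCPDS K S′
  cpds-lift (monitors , connected) =
    (λ i → monitored-lift (monitors (π i)) i refl) , λ i j i∈ j∈ →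
      walk-lift (connected (π i) (π j) (preimage-∈ i∈) (preimage-∈ j∈)) i refl
      ++ʷ fibre-walk S′ (λ k e → ∈-preimage (subst (_∈ S) (sym e) (preimage-∈ j∈))) (π-shift i (π j))

lookup-concat-map-replicate : ∀ {m} n (p : Subset m) a b →
                              lookup (concat (map (replicate n) p)) (combine a b) ≡ lookup p a
lookup-concat-map-replicate n p a b = begin
  lookup (concat (map (replicate n) p)) (combine a b) ≡⟨ lookup-concat (map (replicate n) p) a b ⟩
  lookup (lookup (map (replicate n) p) a) b          ≡⟨ cong (λ q → lookup q b) (lookup-map a (replicate n) p) ⟩
  lookup (replicate n (lookup p a)) b                ≡⟨ lookup-replicate b (lookup p a) ⟩
  lookup p a                                         ∎
  where open ≡-Reasoning

lookup-concat-replicate : ∀ m {n} (p : Subset n) a b → lookup (concat (replicate m p)) (combine a b) ≡ lookup p b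
lookup-concat-replicate m p a b =
  trans (lookup-concat (replicate m p) a b) (cong (λ q → lookup q b) (lookup-replicate a p))

module _ {m n : ℕ} (G : Graph m) (H : Graph n) where

  pair : Fin m → Fin n → Fin (m * n)
  pair = combine

  fst : Fin (m * n) → Fin m
  fst i = proj₁ (remQuot {m} n i)

  snd : Fin (m * n) → Fin n
  snd i = proj₂ (remQuot {m} n i)

  fst-pair : ∀ a b → fst (pair a b) ≡ a
  fst-pair a b = cong proj₁ (remQuot-combine a b)

  snd-pair : ∀ a b → snd (pair a b) ≡ b
  snd-pair a b = cong proj₂ (remQuot-combine a b)

  pair-fst-snd : ∀ i → pair (fst i) (snd i) ≡ i
  pair-fst-snd = combine-remQuot {m} n

  adj-horizontal : ∀ {a x b} → Adj G a x → Adj (G □ H) (pair a b) (pair x b)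
  adj-horizontal {a} {x} {b} g = inj₂ (trans (snd-pair a b) (sym (snd-pair x b)) ,
    subst₂ (Adj G) (sym (fst-pair a b)) (sym (fst-pair x b)) g)

  adj-vertical : ∀ {a b y} → Adj H b y → Adj (G □ H) (pair a b) (pair a y)
  adj-vertical {a} {b} {y} h = inj₁ (trans (fst-pair a b) (sym (fst-pair a y)) ,
    subst₂ (Adj H) (sym (snd-pair a b)) (sym (snd-pair a y)) h)

  walk-horizontal : ∀ {P b a x} → (∀ c → pair c b ∈ P) → WalkIn G ⊤ a x →
                    WalkIn (G □ H) P (pair a b) (pair x b)
  walk-horizontal layer (here _) = here (layer _)
  walk-horizontal layer (step _ g w) = step (layer _) (adj-horizontal g) (walk-horizontal layer w)

  walk-vertical : ∀ {P a b y} → (∀ c → pair a c ∈ P) → WalkIn H ⊤ b y →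
                  WalkIn (G □ H) P (pair a b) (pair a y)
  walk-vertical fibre (here _) = here (fibre _)
  walk-vertical fibre (step _ h w) = step (fibre _) (adj-vertical h) (walk-vertical fibre w)

  □-proj₁ : IsConnected H → Projection (G □ H) G
  □-proj₁ connected = record
    { π           = fst
    ; shift       = λ i u → pair u (snd i)
    ; π-shift     = λ i u → fst-pair u (snd i)
    ; shift-π     = pair-fst-snd
    ; shift-shift = λ i u v → cong (pair v) (snd-pair u (snd i))
    ; adj-shift   = λ {i} g → subst (λ z → Adj (G □ H) z (pair _ (snd i))) (pair-fst-snd i) (adj-horizontal g)
    ; shift-adj   = λ {i} g → subst (Adj (G □ H) (pair _ (snd i))) (pair-fst-snd i) (adj-horizontal g)
    ; adj-split   = split
    ; fibre-walk  = λ {i} {j} P fibre e →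
        subst₂ (WalkIn (G □ H) P)
          (trans (cong (λ a → pair a (snd i)) (sym e)) (pair-fst-snd i)) (pair-fst-snd j)
          (walk-vertical (λ c → fibre _ (fst-pair (fst j) c)) (connected _ _))
    }
    where
    split : ∀ {i k} → Adj (G □ H) i k → fst i ≡ fst k ⊎ (Adj G (fst i) (fst k) × k ≡ pair (fst k) (snd i))
    split (inj₁ (e , _)) = inj₁ e
    split {k = k} (inj₂ (e , g)) = inj₂ (g , sym (trans (cong (pair (fst k)) e) (pair-fst-snd k)))

  □-proj₂ : IsConnected G → Projection (G □ H) H
  □-proj₂ connected = record
    { π           = snd
    ; shift       = λ i u → pair (fst i) u
    ; π-shift     = λ i u → snd-pair (fst i) u
    ; shift-π     = pair-fst-snd
    ; shift-shift = λ i u v → cong (λ a → pair a v) (fst-pair (fst i) u)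
    ; adj-shift   = λ {i} h → subst (λ z → Adj (G □ H) z (pair (fst i) _)) (pair-fst-snd i) (adj-vertical h)
    ; shift-adj   = λ {i} h → subst (Adj (G □ H) (pair (fst i) _)) (pair-fst-snd i) (adj-vertical h)
    ; adj-split   = split
    ; fibre-walk  = λ {i} {j} P fibre e →
        subst₂ (WalkIn (G □ H) P)
          (trans (cong (pair (fst i)) (sym e)) (pair-fst-snd i)) (pair-fst-snd j)
          (walk-horizontal (λ c → fibre _ (snd-pair c (snd j))) (connected _ _))
    }
    where
    split : ∀ {i k} → Adj (G □ H) i k → snd i ≡ snd k ⊎ (Adj H (snd i) (snd k) × k ≡ pair (fst i) (snd k))
    split (inj₂ (e , _)) = inj₁ e
    split {k = k} (inj₁ (e , h)) = inj₂ (h , sym (trans (cong (λ a → pair a (snd k)) e) (pair-fst-snd k)))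

  cpds-□₁ : IsConnected H → ∀ S → IsCPDS G S → IsCPDS (G □ H) (concat (map (replicate n) S))
  cpds-□₁ connected S = Preimage.cpds-lift (□-proj₁ connected) S S′ λ i →
    trans (cong (lookup S′) (sym (pair-fst-snd i))) (lookup-concat-map-replicate n S (fst i) (snd i))
    where S′ = concat (map (replicate n) S)

  cpds-□₂ : IsConnected G → ∀ T → IsCPDS H T → IsCPDS (G □ H) (concat (replicate m T))
  cpds-□₂ connected T = Preimage.cpds-lift (□-proj₂ connected) T T′ λ i →
    trans (cong (lookup T′) (sym (pair-fst-snd i))) (lookup-concat-replicate m T (fst i) (snd i))
    where T′ = concat (replicate m T)

theorem2 : ∀ {m n : ℕ} (G : Graph m) (H : Graph n) →
    2 ≤ m → 2 ≤ n → IsSimple G → IsSimple H → IsConnected G → IsConnected H →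
    ∀ (kG kH kGH : ℕ) → IsγPc G kG → IsγPc H kH → IsγPc (G □ H) kGH →
    kGH ≤ (kG * n) ⊓ (kH * m)
theorem2 {m} {n} G H _ _ _ _ connectedG connectedH _ _ _
         ((S , cpdsS , refl) , _) ((T , cpdsT , refl) , _) (_ , minimal) =
  ⊓-glb
    (≤-trans (minimal _ (cpds-□₁ G H connectedH S cpdsS))
      (≤-reflexive (∣concat-map-replicate∣ n S)))
    (≤-trans (minimal _ (cpds-□₂ G H connectedG T cpdsT))
      (≤-reflexive (trans (∣concat-replicate∣ m T) (*-comm m ∣ T ∣))))
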